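{- Let $(P,\le)$ be a finite poset with elements $p_1,\ldots,p_n$ (listed in some order, all distinct), and for $p\in P$ let $p\!\downarrow=\{b\in P: b\le p\}$ be the principal ideal of $p$. Then the sequence $(p_1\!\downarrow,\ldots,p_n\!\downarrow)$ is a peeling of the family $\{p\!\downarrow: p\in P\}$ if and only if $(p_1,\ldots,p_n)$ is a linear extension of $(P,\le)$, i.e. $p_i<p_j$ implies $i<j$.
   Context: For finite sets $X,Y$, the notation $X\prec Y$ means that $X\subseteq Y$ and $|X|=|Y|-1$. Given finite sets $F_1,\ldots,F_n$, a permutation $(G_1,\ldots,G_n)$ of $F_1,\ldots,F_n$ is called a peeling if for all $2\le k\le n$ one has $(G_1\cup\cdots\cup G_{k-1})\cap G_k\prec G_k$. -}

module Defs where

open import Data.Nat as ℕ using (ℕ; suc; _+_)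
open import Data.Fin using (Fin; toℕ; _<_)
open import Data.Fin.Subset using (Subset; _⊆_; _∩_; ⋃; ∣_∣)
open import Data.Vec using (tabulate)
open import Data.List using (List; map; filter)
open import Data.Product using (Σ; _×_)
open import Function.Definitions using (Injective)
open import Relation.Nullary using (¬_; does)
open import Relation.Binary.PropositionalEquality using (_≡_)
open import Relation.Binary.Definitions using (Decidable)
open import Data.List.Base using (allFin)

_≺_ : ∀ {m} → Subset m → Subset m → Set
X ≺ Y = X ⊆ Y × suc ∣ X ∣ ≡ ∣ Y ∣

unionBefore : ∀ {n m} → (Fin n → Subset m) → Fin n → Subset m
unionBefore {n} G k = ⋃ (map G (filter (λ i → toℕ i ℕ.<? toℕ k) (allFin n)))

-- The sequence G (indexed by Fin n) is a peeling of the family F (indexed by Fin n):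
-- G is a permutation of F, and for every position k ≥ 2 (1-based),
-- (G₁ ∪ … ∪ G_{k-1}) ∩ G_k ≺ G_k.  (For k = 1 the condition is vacuous/not required.)
IsPeelingOf : ∀ {n m} → (Fin n → Subset m) → (Fin n → Subset m) → Set
IsPeelingOf {n} F G =
  Σ (Fin n → Fin n) (λ π → Injective _≡_ _≡_ π × (∀ k → G k ≡ F (π k)))
  × (∀ (k : Fin n) → 1 ℕ.≤ toℕ k → (unionBefore G k ∩ G k) ≺ G k)

ideal : ∀ {n} {_≤_ : Fin n → Fin n → Set} → Decidable _≤_ → Fin n → Subset n
ideal dec p = tabulate (λ b → does (dec b p))

Strict : ∀ {n} → (Fin n → Fin n → Set) → Fin n → Fin n → Set
Strict _≤_ a b = a ≤ b × ¬ (a ≡ b)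

-- If the enumeration is a linear extension, the members of P placed before p_k and lying
-- below p_k are exactly the elements of p_k↓ other than p_k, so each new ideal meets the
-- earlier union in p_k↓ - p_k, which has one element less.  Conversely, if p_i < p_j with
-- j < i, then p_i↓ ⊆ p_j↓ is swallowed entirely by the earlier union, so the intersection
-- at position i is all of p_i↓ and cannot be one element smaller.
module Submission where

open import Defs
open import Data.Nat using (ℕ)
open import Data.Fin using (Fin; _<_)
open import Function using (_∘_)
open import Function.Bundles using (_⇔_)
open import Function.Definitions using (Bijective)
open import Relation.Binary.PropositionalEquality using (_≡_)
open import Relation.Binary.Structures using (IsDecPartialOrder)

open import Data.Bool using (Bool; true)
open import Data.Nat as ℕ using (suc; z≤n; s≤s)
open import Data.Empty using (⊥-elim)
open import Data.Fin using (toℕ)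
open import Data.Fin.Properties using (<-cmp)
open import Data.Fin.Subset
  using (Subset; inside; outside; _∈_; _∉_; _⊆_; _∩_; _─_; _-_; ⋃; ∣_∣; ⁅_⁆)
open import Data.Fin.Subset.Properties
open import Data.List using (List; []; _∷_; allFin)
import Data.List.Membership.Propositional as List
open import Data.List.Membership.Propositional.Properties
  using (∈-map⁺; ∈-map⁻; ∈-filter⁺; ∈-filter⁻; ∈-allFin)
open import Data.List.Relation.Unary.Any as Any using ()
import Data.Nat.Properties as ℕₚ
open import Data.Product using (∃; _×_; _,_; proj₂)
open import Data.Sum using (inj₁; inj₂)
open import Data.Vec using (_∷_; here; there; tabulate)
open import Data.Vec.Properties using ([]=⇒lookup; lookup⇒[]=; lookup∘tabulate)
open import Function.Bundles using (mk⇔)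
open import Function.Definitions using (Injective; Surjective)
open import Relation.Binary.Definitions using (Decidable; tri<; tri≈; tri>)
open import Relation.Binary.PropositionalEquality using (_≢_; refl; sym; trans; cong; subst)
open import Relation.Nullary using (¬_; Dec; yes; does)
open import Relation.Nullary.Decidable using (dec-true)

private
  variable
    m n : ℕ

x∈tabulate⁺ : (f : Fin n → Bool) {x : Fin n} → f x ≡ true → x ∈ tabulate f
x∈tabulate⁺ f {x} fx≡true = lookup⇒[]= x _ (trans (lookup∘tabulate f x) fx≡true)

x∈tabulate⁻ : (f : Fin n → Bool) {x : Fin n} → x ∈ tabulate f → f x ≡ true
x∈tabulate⁻ f {x} x∈tf = trans (sym (lookup∘tabulate f x)) ([]=⇒lookup x∈tf)

x∈⋃⁺ : {x : Fin n} {p : Subset n} (ps : List (Subset n)) → p List.∈ ps → x ∈ p → x ∈ ⋃ ps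
x∈⋃⁺ (_ ∷ ps) (Any.here refl) x∈p = x∈p∪q⁺ (inj₁ x∈p)
x∈⋃⁺ (_ ∷ ps) (Any.there p∈ps) x∈p = x∈p∪q⁺ (inj₂ (x∈⋃⁺ ps p∈ps x∈p))

x∈⋃⁻ : {x : Fin n} (ps : List (Subset n)) → x ∈ ⋃ ps → ∃ λ p → p List.∈ ps × x ∈ p
x∈⋃⁻ [] x∈⊥ = ⊥-elim (∉⊥ x∈⊥)
x∈⋃⁻ (q ∷ ps) x∈q∪⋃ps with x∈p∪q⁻ q (⋃ ps) x∈q∪⋃ps
... | inj₁ x∈q = q , Any.here refl , x∈q
... | inj₂ x∈⋃ps with x∈⋃⁻ ps x∈⋃ps
...   | p , p∈ps , x∈p = p , Any.there p∈ps , x∈p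

x∈p─q⇒x∉q : (p q : Subset n) {x : Fin n} → x ∈ p ─ q → x ∉ q
x∈p─q⇒x∉q (inside ∷ p) (outside ∷ q) here ()
x∈p─q⇒x∉q (_ ∷ p) (_ ∷ q) (there x∈p─q) (there x∈q) = x∈p─q⇒x∉q p q x∈p─q x∈q

x∈p-y⇒x≢y : (p : Subset n) {x y : Fin n} → x ∈ p - y → x ≢ y
x∈p-y⇒x≢y p {y = y} x∈p-y = x∉⁅y⁆⇒x≢y (x∈p─q⇒x∉q p ⁅ y ⁆ x∈p-y)

∣p-x∣+1≡∣p∣ : (p : Subset n) {x : Fin n} → x ∈ p → suc ∣ p - x ∣ ≡ ∣ p ∣
∣p-x∣+1≡∣p∣ (inside ∷ p) here = cong suc (cong ∣_∣ (p─⊥≡p p))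
∣p-x∣+1≡∣p∣ (inside ∷ p) (there x∈p) = cong suc (∣p-x∣+1≡∣p∣ p x∈p)
∣p-x∣+1≡∣p∣ (outside ∷ p) (there x∈p) = ∣p-x∣+1≡∣p∣ p x∈p

p-x≺p : (p : Subset n) {x : Fin n} → x ∈ p → (p - x) ≺ p
p-x≺p p {x} x∈p = p─q⊆p p ⁅ x ⁆ , ∣p-x∣+1≡∣p∣ p x∈p

q⊆p⇒p⊀q : {p q : Subset n} → q ⊆ p → ¬ (p ≺ q)
q⊆p⇒p⊀q q⊆p (_ , 1+∣p∣≡∣q∣) =
  ℕₚ.<-irrefl refl (ℕₚ.≤-trans (ℕₚ.≤-reflexive 1+∣p∣≡∣q∣) (p⊆q⇒∣p∣≤∣q∣ q⊆p))

module _ (G : Fin n → Subset m) where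

  x∈unionBefore⁺ : {i k : Fin n} {x : Fin m} → i < k → x ∈ G i → x ∈ unionBefore G k
  x∈unionBefore⁺ {i} {k} i<k x∈Gi =
    x∈⋃⁺ _ (∈-map⁺ G (∈-filter⁺ (λ i → toℕ i ℕ.<? toℕ k) (∈-allFin i) i<k)) x∈Gi

  x∈unionBefore⁻ : (k : Fin n) {x : Fin m} → x ∈ unionBefore G k → ∃ λ i → i < k × x ∈ G i
  x∈unionBefore⁻ k x∈⋃ with x∈⋃⁻ _ x∈⋃
  ... | _ , q∈Gs , x∈q with ∈-map⁻ G q∈Gs
  ...   | i , i∈filtered , refl =
    i , proj₂ (∈-filter⁻ (λ i → toℕ i ℕ.<? toℕ k) {xs = allFin n} i∈filtered) , x∈q

does≡true⇒ : ∀ {a} {A : Set a} (a? : Dec A) → does a? ≡ true → A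
does≡true⇒ (yes a) _ = a

module _ {_≤_ : Fin n → Fin n → Set} (_≤?_ : Decidable _≤_) where

  x∈ideal⁺ : {x q : Fin n} → x ≤ q → x ∈ ideal _≤?_ q
  x∈ideal⁺ {x} {q} x≤q = x∈tabulate⁺ (λ b → does (b ≤? q)) (dec-true (x ≤? q) x≤q)

  x∈ideal⁻ : {x q : Fin n} → x ∈ ideal _≤?_ q → x ≤ q
  x∈ideal⁻ {x} {q} x∈q↓ = does≡true⇒ (x ≤? q) (x∈tabulate⁻ (λ b → does (b ≤? q)) x∈q↓)

IsLinearExtension : (Fin n → Fin n → Set) → (Fin n → Fin n) → Set
IsLinearExtension _≤_ p = ∀ i j → Strict _≤_ (p i) (p j) → i < j

module _ {_≤_ : Fin n → Fin n → Set} (po : IsDecPartialOrder _≡_ _≤_) (p : Fin n → Fin n) where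

  open IsDecPartialOrder po using (_≤?_) renaming (refl to ≤-refl; trans to ≤-trans)

  private
    G : Fin n → Subset n
    G = ideal _≤?_ ∘ p

  ideal⊆unionBefore∩ideal : {i j : Fin n} → j < i → p i ≤ p j → G i ⊆ unionBefore G i ∩ G i
  ideal⊆unionBefore∩ideal j<i pi≤pj x∈Gi =
    x∈p∩q⁺ (x∈unionBefore⁺ G j<i (x∈ideal⁺ _≤?_ (≤-trans (x∈ideal⁻ _≤?_ x∈Gi) pi≤pj)) , x∈Gi)

  peeling⇒isLinearExtension : (∀ k → 1 ℕ.≤ toℕ k → (unionBefore G k ∩ G k) ≺ G k) →
                              IsLinearExtension _≤_ p
  peeling⇒isLinearExtension peel i j (pi≤pj , pi≢pj) with <-cmp i j
  ... | tri< i<j _ _ = i<j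
  ... | tri≈ _ i≡j _ = ⊥-elim (pi≢pj (cong p i≡j))
  ... | tri> _ _ j<i = ⊥-elim (q⊆p⇒p⊀q (ideal⊆unionBefore∩ideal j<i pi≤pj) (peel i 1≤i))
    where 1≤i = ℕₚ.≤-trans (s≤s z≤n) j<i

  module _ (linear : IsLinearExtension _≤_ p) where

    unionBefore∩ideal⊆ideal-top : Injective _≡_ _≡_ p →
                                  (k : Fin n) → unionBefore G k ∩ G k ⊆ G k - p k
    unionBefore∩ideal⊆ideal-top p-injective k {x} x∈⋃∩Gk with x∈p∩q⁻ _ _ x∈⋃∩Gk
    ... | x∈⋃ , x∈Gk with x∈unionBefore⁻ G k x∈⋃
    ...   | i , i<k , x∈Gi = x∈p∧x≢y⇒x∈p-y x∈Gk x≢pk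
      where
      x≢pk : x ≢ p k
      x≢pk refl = ℕₚ.<-asym i<k (linear k i (x∈ideal⁻ _≤?_ x∈Gi , pk≢pi))
        where pk≢pi = λ pk≡pi → ℕₚ.<-irrefl (cong toℕ (p-injective (sym pk≡pi))) i<k

    ideal-top⊆unionBefore∩ideal : Surjective _≡_ _≡_ p →
                                  (k : Fin n) → G k - p k ⊆ unionBefore G k ∩ G k
    ideal-top⊆unionBefore∩ideal p-surjective k {x} x∈Gk-pk with p-surjective x
    ... | i , pi≡x with pi≡x refl
    ...   | refl = x∈p∩q⁺ (x∈unionBefore⁺ G i<k (x∈ideal⁺ _≤?_ ≤-refl) , x∈Gk)
      where
      x∈Gk = p─q⊆p (G k) ⁅ p k ⁆ x∈Gk-pk
      i<k = linear i k (x∈ideal⁻ _≤?_ x∈Gk , x∈p-y⇒x≢y (G k) x∈Gk-pk)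

    isLinearExtension⇒peeling : Bijective _≡_ _≡_ p → IsPeelingOf (ideal _≤?_) G
    isLinearExtension⇒peeling (p-injective , p-surjective) =
      (p , p-injective , λ _ → refl) , λ k _ →
      subst (_≺ G k)
            (⊆-antisym (ideal-top⊆unionBefore∩ideal p-surjective k)
                       (unionBefore∩ideal⊆ideal-top p-injective k))
            (p-x≺p (G k) (x∈ideal⁺ _≤?_ ≤-refl))

mainTheorem2 : (n : ℕ) (_≤_ : Fin n → Fin n → Set)
    (po : IsDecPartialOrder _≡_ _≤_)
    (p : Fin n → Fin n) → Bijective _≡_ _≡_ p →
    IsPeelingOf (ideal (IsDecPartialOrder._≤?_ po)) (ideal (IsDecPartialOrder._≤?_ po) ∘ p)
    ⇔ (∀ i j → Strict _≤_ (p i) (p j) → i < j)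
mainTheorem2 n _≤_ po p p-bijective = mk⇔
  (λ (_ , peel) → peeling⇒isLinearExtension po p peel)
  (λ linear → isLinearExtension⇒peeling po p linear p-bijective)
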